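{- Let $G$ be a cubic graph and $S$ a DET:OLD set of $G$. Then for every vertex $v\in V(G)\setminus S$, we have $T_2(v)\cup T_4(v)\subseteq S$.
   Context: For a graph $G$ and $v\in V(G)$, $N(v)$ is the open neighborhood of $v$. For $S\subseteq V(G)$ write $N_S(v)=N(v)\cap S$. A set $S\subseteq V(G)$ is a DET:OLD set of $G$ if (1) every vertex $v$ satisfies $|N_S(v)|\ge 2$, and (2) every pair of distinct vertices $u,v$ satisfies $|N_S(u)\setminus N_S(v)|\ge 2$ or $|N_S(v)\setminus N_S(u)|\ge 2$. A cubic graph is a 3-regular simple graph. A trail of length $k$ is a walk $v_0v_1\cdots v_k$ whose $k$ edges $v_{i-1}v_i$ are pairwise distinct; $T_k(v)$ denotes the set of vertices $w$ such that there is a trail of length $k$ from $v$ to $w$. -}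

module Defs where

open import Data.Nat using (ℕ; zero; suc; _≥_)
open import Data.Bool using (Bool; true; false; T)
open import Data.Fin using (Fin; zero; suc)
open import Data.Fin.Subset using (Subset; _∩_; _─_; ∣_∣; _∈_; _∉_; _∪_; _⊆_)
open import Data.Vec using (Vec; tabulate; lookup; _∷_; [])
open import Data.Product using (_×_; Σ; ∃; _,_)
open import Data.Sum using (_⊎_)
open import Relation.Binary.PropositionalEquality using (_≡_; _≢_)
open import Relation.Nullary using (¬_)

record Graph (n : ℕ) : Set where
  field
    adj       : Fin n → Fin n → Bool
    adj-sym   : ∀ u v → adj u v ≡ adj v u
    adj-irrefl : ∀ v → adj v v ≡ false
open Graph public

N : ∀ {n} → Graph n → Fin n → Subset n
N G v = tabulate (adj G v)

N[_]_ : ∀ {n} → Graph n → Subset n → Fin n → Subset n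
(N[ G ] S) v = N G v ∩ S

Cubic : ∀ {n} → Graph n → Set
Cubic G = ∀ v → ∣ N G v ∣ ≡ 3

IsDetOLD : ∀ {n} → Graph n → Subset n → Set
IsDetOLD G S =
  (∀ v → ∣ (N[ G ] S) v ∣ ≥ 2) ×
  (∀ u v → u ≢ v →
     (∣ (N[ G ] S) u ─ (N[ G ] S) v ∣ ≥ 2) ⊎ (∣ (N[ G ] S) v ─ (N[ G ] S) u ∣ ≥ 2))

SameEdge : ∀ {n} → Fin n → Fin n → Fin n → Fin n → Set
SameEdge a b c d = (a ≡ c × b ≡ d) ⊎ (a ≡ d × b ≡ c)

IsWalk : ∀ {n} → Graph n → (k : ℕ) → (Fin (suc k) → Fin n) → Set
IsWalk G k w = ∀ (i : Fin k) → T (adj G (w (Data.Fin.inject₁ i)) (w (suc i)))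

IsTrail : ∀ {n} → Graph n → (k : ℕ) → (Fin (suc k) → Fin n) → Set
IsTrail G k w = IsWalk G k w ×
  (∀ (i j : Fin k) → i ≢ j →
     ¬ SameEdge (w (Data.Fin.inject₁ i)) (w (suc i)) (w (Data.Fin.inject₁ j)) (w (suc j)))

InT : ∀ {n} → Graph n → (k : ℕ) → Fin n → Fin n → Set
InT {n} G k v x = Σ (Fin (suc k) → Fin n) λ w →
  IsTrail G k w × w zero ≡ v × w (Data.Fin.fromℕ k) ≡ x

{-# OPTIONS --safe #-}
module Submission where

-- A vertex a has at least two S-neighbours, so in a cubic graph at most one neighbour of a
-- lies outside S; hence a trail v a x with v ∉ S has x ∈ S.  For a trail v a b c x with
-- v, x ∉ S, this gives b ∈ S, and a, c each have exactly two S-neighbours; sharing b,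
-- neither N_S(a) ∖ N_S(c) nor N_S(c) ∖ N_S(a) can have two elements, contradicting the
-- separation condition (a ≠ c because the edges ab and bc differ).

open import Defs
open import Data.Nat using (ℕ; suc; _+_; _≤_; _<_; s≤s⁻¹)
open import Data.Nat.Properties using (≤-<-trans; <-≤-trans; <⇒≱; 1+n≢n)
open import Data.Bool using (T)
open import Data.Bool.Properties using (T-≡)
open import Data.Fin using (Fin; zero; suc; inject₁; toℕ)
open import Data.Fin.Properties using (_≟_; toℕ-inject₁)
open import Data.Fin.Subset using (Subset; _∈_; _∉_; _∩_; _─_; ∣_∣; ⁅_⁆)
open import Data.Fin.Subset.Properties
  using (p⊂q⇒∣p∣<∣q∣; p∩q⊆p; x∈p∩q⁺; x∈p∩q⁻; p∩q≢∅⇒∣p─q∣<∣p∣; x∈p∧x∉q⇒x∈p─q;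
         x∈⁅x⁆; x∈⁅y⁆⇒x≡y; _∈?_)
open import Data.Vec.Properties using (lookup⇒[]=; lookup∘tabulate)
open import Data.Sum using (_⊎_; inj₁; inj₂)
open import Data.Product using (_,_; proj₁; proj₂)
open import Function using (_∘_; Equivalence)
open import Relation.Nullary using (yes; no; contradiction)
open import Relation.Nullary.Decidable using (decidable-stable)
open import Relation.Binary.PropositionalEquality using (_≡_; _≢_; refl; sym; trans; cong; subst)

module _ {n : ℕ} {p q : Subset n} where

  x∈p∧x∉q⇒∣p∩q∣<∣p∣ : ∀ {x} → x ∈ p → x ∉ q → ∣ p ∩ q ∣ < ∣ p ∣
  x∈p∧x∉q⇒∣p∩q∣<∣p∣ {x} x∈p x∉q =
    p⊂q⇒∣p∣<∣q∣ (p∩q⊆p p q , x , x∈p , x∉q ∘ proj₂ ∘ x∈p∩q⁻ p q)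

  -- p ∩ q sits strictly inside p ─ ⁅ x ⁆, which sits strictly inside p.
  x,y∈p∧x,y∉q⇒2+∣p∩q∣≤∣p∣ : ∀ {x y} → x ≢ y → x ∈ p → y ∈ p → x ∉ q → y ∉ q →
                            2 + ∣ p ∩ q ∣ ≤ ∣ p ∣
  x,y∈p∧x,y∉q⇒2+∣p∩q∣≤∣p∣ {x} {y} x≢y x∈p y∈p x∉q y∉q =
    ≤-<-trans p∩q<p─x (p∩q≢∅⇒∣p─q∣<∣p∣ p ⁅ x ⁆ (x , x∈p∩q⁺ (x∈p , x∈⁅x⁆ x)))
    where
    p∩q<p─x : ∣ p ∩ q ∣ < ∣ p ─ ⁅ x ⁆ ∣
    p∩q<p─x = p⊂q⇒∣p∣<∣q∣
      ( (λ {z} z∈p∩q → let z∈p , z∈q = x∈p∩q⁻ p q z∈p∩q in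
           x∈p∧x∉q⇒x∈p─q z∈p (λ z∈x → x∉q (subst (_∈ q) (x∈⁅y⁆⇒x≡y x z∈x) z∈q)))
      , y , x∈p∧x∉q⇒x∈p─q y∈p (x≢y ∘ sym ∘ x∈⁅y⁆⇒x≡y x)
      , y∉q ∘ proj₂ ∘ x∈p∩q⁻ p q )

inject₁≢suc : ∀ {k} (i : Fin k) → inject₁ i ≢ suc i
inject₁≢suc i eq = 1+n≢n (sym (trans (sym (toℕ-inject₁ i)) (cong toℕ eq)))

module _ {n : ℕ} (G : Graph n) where

  adj⇒∈N : ∀ {u v} → T (adj G u v) → v ∈ N G u
  adj⇒∈N {u} {v} uv = lookup⇒[]= v (N G u)
    (trans (lookup∘tabulate (adj G u) v) (Equivalence.to T-≡ uv))

  adj⇒∈N′ : ∀ {u v} → T (adj G u v) → u ∈ N G v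
  adj⇒∈N′ {u} {v} = adj⇒∈N ∘ subst T (adj-sym G u v)

  trail⇒skip-≢ : ∀ {k} w → IsTrail G (suc k) w → ∀ (i : Fin k) →
                 w (inject₁ (inject₁ i)) ≢ w (suc (suc i))
  trail⇒skip-≢ w (_ , distinct) i eq =
    distinct (inject₁ i) (suc i) (inject₁≢suc i) (inj₂ (eq , refl))

  module _ (S : Subset n) (det : IsDetOLD G S) where

    shared-S-neighbour⇒∣─∣<2 : ∀ {a b c} → ∣ (N[ G ] S) a ∣ ≤ 2 →
                              b ∈ (N[ G ] S) a → b ∈ (N[ G ] S) c →
                              ∣ (N[ G ] S) a ─ (N[ G ] S) c ∣ < 2
    shared-S-neighbour⇒∣─∣<2 a≤2 b∈a b∈c =
      <-≤-trans (p∩q≢∅⇒∣p─q∣<∣p∣ _ _ (_ , x∈p∩q⁺ (b∈a , b∈c))) a≤2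

    shared-S-neighbour⇒≡ : ∀ {a b c} → ∣ (N[ G ] S) a ∣ ≤ 2 → ∣ (N[ G ] S) c ∣ ≤ 2 →
                           b ∈ (N[ G ] S) a → b ∈ (N[ G ] S) c → a ≡ c
    shared-S-neighbour⇒≡ {a} {b} {c} a≤2 c≤2 b∈a b∈c with a ≟ c
    ... | yes a≡c = a≡c
    ... | no a≢c with proj₂ det a c a≢c
    ...   | inj₁ 2≤a─c with () ← <⇒≱ (shared-S-neighbour⇒∣─∣<2 a≤2 b∈a b∈c) 2≤a─c
    ...   | inj₂ 2≤c─a with () ← <⇒≱ (shared-S-neighbour⇒∣─∣<2 c≤2 b∈c b∈a) 2≤c─a

    module _ (cubic : Cubic G) where

      outside-neighbour⇒∣N[S]∣≤2 : ∀ {a x} → x ∈ N G a → x ∉ S → ∣ (N[ G ] S) a ∣ ≤ 2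
      outside-neighbour⇒∣N[S]∣≤2 {a} x∈Na x∉S =
        s≤s⁻¹ (subst (∣ (N[ G ] S) a ∣ <_) (cubic a) (x∈p∧x∉q⇒∣p∩q∣<∣p∣ x∈Na x∉S))

      outside-neighbour-unique : ∀ {a x y} → x ∈ N G a → y ∈ N G a → x ∉ S → y ∉ S → x ≡ y
      outside-neighbour-unique {a} {x} {y} x∈Na y∈Na x∉S y∉S with x ≟ y
      ... | yes x≡y = x≡y
      ... | no x≢y = contradiction (proj₁ det a) (<⇒≱ ∣N[S]∣<2)
        where
        ∣N[S]∣<2 : ∣ (N[ G ] S) a ∣ < 2
        ∣N[S]∣<2 = s≤s⁻¹ (subst (2 + ∣ (N[ G ] S) a ∣ ≤_) (cubic a)
          (x,y∈p∧x,y∉q⇒2+∣p∩q∣≤∣p∣ x≢y x∈Na y∈Na x∉S y∉S))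

      other-neighbour∈S : ∀ {a x y} → x ∈ N G a → y ∈ N G a → x ≢ y → x ∉ S → y ∈ S
      other-neighbour∈S x∈Na y∈Na x≢y x∉S =
        decidable-stable (_ ∈? S) (x≢y ∘ outside-neighbour-unique x∈Na y∈Na x∉S)

      trail⇒w₂∈S : ∀ {k} w → IsTrail G (suc (suc k)) w → w zero ∉ S → w (suc (suc zero)) ∈ S
      trail⇒w₂∈S w trail@(walk , _) =
        other-neighbour∈S (adj⇒∈N′ (walk zero)) (adj⇒∈N (walk (suc zero)))
          (trail⇒skip-≢ w trail zero)

      trail⇒w₄∈S : ∀ {k} w → IsTrail G (suc (suc (suc (suc k)))) w → w zero ∉ S →
                   w (suc (suc (suc (suc zero)))) ∈ S
      trail⇒w₄∈S w trail@(walk , _) w₀∉S = decidable-stable (_ ∈? S) λ w₄∉S →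
        trail⇒skip-≢ w trail (suc zero) (shared-S-neighbour⇒≡
          (outside-neighbour⇒∣N[S]∣≤2 (adj⇒∈N′ (walk zero)) w₀∉S)
          (outside-neighbour⇒∣N[S]∣≤2 (adj⇒∈N (walk (suc (suc (suc zero))))) w₄∉S)
          (x∈p∩q⁺ (adj⇒∈N (walk (suc zero)) , w₂∈S))
          (x∈p∩q⁺ (adj⇒∈N′ (walk (suc (suc zero))) , w₂∈S)))
        where
        w₂∈S : w (suc (suc zero)) ∈ S
        w₂∈S = trail⇒w₂∈S w trail w₀∉S

mainTheorem8 : ∀ {n : ℕ} (G : Graph n) (S : Subset n) →
    Cubic G → IsDetOLD G S →
    ∀ (v : Fin n) → v ∉ S →
    ∀ (x : Fin n) → (InT G 2 v x ⊎ InT G 4 v x) → x ∈ S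
mainTheorem8 G S cubic det v v∉S x (inj₁ (w , trail , refl , refl)) =
  trail⇒w₂∈S G S det cubic w trail v∉S
mainTheorem8 G S cubic det v v∉S x (inj₂ (w , trail , refl , refl)) =
  trail⇒w₄∈S G S det cubic w trail v∉S
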